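{- Let $G$ be a finite simple graph with maximum degree $\Delta(G) \ge 3$ satisfying $Z(G) = (\Delta(G) - 2)\beta(G) + 1$, and let $G'$ be any graph obtained by applying $(\Delta(G)-1)$-LSVA to $G$. Then $Z(G') = (\Delta(G') - 2)\beta(G') + 1$.
   Context: For an integer $k$, a $k$-leaf support vertex addition ($k$-LSVA) on a graph $G$ is the operation of choosing a vertex $v \in V(G)$ with degree $d_G(v) \le k-1$, adding a new vertex $w$ adjacent to $v$, and then adding $k$ new vertices each adjacent only to $w$ (leaves attached to $w$). A vertex cover of a graph is a set of vertices containing at least one endpoint of every edge; $\beta$ denotes the minimum size of a vertex cover. Zero forcing process: starting from a set $B$ of blue vertices (others white), repeatedly, if a blue vertex has exactly one white neighbor, that neighbor becomes blue; $B$ is a zero forcing set if all vertices eventually become blue; $Z$ denotes the minimum size of a zero forcing set. -}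

module Defs where

open import Data.Nat using (ℕ; zero; suc; _+_; _≤_; _⊔_)
open import Data.Bool using (Bool; true; false; if_then_else_)
open import Data.Fin using (Fin; zero; suc; splitAt; _≟_)
open import Data.Sum using (_⊎_; inj₁; inj₂)
open import Data.List using (List; allFin; map; foldr)
open import Data.Nat.ListAction using (sum)
open import Data.Product using (Σ; _×_; ∃)
open import Relation.Nullary.Decidable using (⌊_⌋)
open import Relation.Binary.PropositionalEquality using (_≡_)

Graph : ℕ → Set
Graph n = Fin n → Fin n → Bool

SimpleGraph : {n : ℕ} → Graph n → Set
SimpleGraph {n} G = (∀ u v → G u v ≡ G v u) × (∀ v → G v v ≡ false)

VSet : ℕ → Set
VSet n = Fin n → Bool

count : {n : ℕ} → (Fin n → Bool) → ℕ
count {n} S = sum (map (λ u → if S u then 1 else 0) (allFin n))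

deg : {n : ℕ} → Graph n → Fin n → ℕ
deg G v = count (G v)

maxDeg : {n : ℕ} → Graph n → ℕ
maxDeg {n} G = foldr _⊔_ 0 (map (deg G) (allFin n))

IsVertexCover : {n : ℕ} → Graph n → VSet n → Set
IsVertexCover G S = ∀ u v → G u v ≡ true → (S u ≡ true) ⊎ (S v ≡ true)

IsVertexCoverNumber : {n : ℕ} → Graph n → ℕ → Set
IsVertexCoverNumber G b =
  (Σ _ λ S → IsVertexCover G S × count S ≡ b) ×
  (∀ S → IsVertexCover G S → b ≤ count S)

paint : {n : ℕ} → VSet n → Fin n → VSet n
paint B u x = if ⌊ x ≟ u ⌋ then true else B x

data Force {n : ℕ} (G : Graph n) (B : VSet n) : VSet n → Set where
  force : (v u : Fin n) → B v ≡ true → G v u ≡ true → B u ≡ false →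
          (∀ w → G v w ≡ true → B w ≡ false → w ≡ u) →
          Force G B (paint B u)

data Forces {n : ℕ} (G : Graph n) : VSet n → VSet n → Set where
  done : ∀ {B} → Forces G B B
  step : ∀ {B C D} → Force G B C → Forces G C D → Forces G B D

IsZeroForcingSet : {n : ℕ} → Graph n → VSet n → Set
IsZeroForcingSet G B = Σ _ λ C → Forces G B C × (∀ x → C x ≡ true)

IsZeroForcingNumber : {n : ℕ} → Graph n → ℕ → Set
IsZeroForcingNumber G z =
  (Σ _ λ B → IsZeroForcingSet G B × count B ≡ z) ×
  (∀ B → IsZeroForcingSet G B → z ≤ count B)

-- k-leaf support vertex addition at v.  Vertex set Fin (n + suc k):
-- the first n are the old vertices, the next is the new vertex w,
-- and the last k are the leaves attached to w.
lsvaAdj : {n k : ℕ} → Graph n → Fin n → (Fin n ⊎ Fin (suc k)) → (Fin n ⊎ Fin (suc k)) → Bool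
lsvaAdj G v (inj₁ a) (inj₁ b) = G a b
lsvaAdj G v (inj₁ a) (inj₂ zero) = ⌊ a ≟ v ⌋
lsvaAdj G v (inj₂ zero) (inj₁ a) = ⌊ a ≟ v ⌋
lsvaAdj G v (inj₂ zero) (inj₂ (suc _)) = true
lsvaAdj G v (inj₂ (suc _)) (inj₂ zero) = true
lsvaAdj G v _ _ = false

lsva : {n : ℕ} → Graph n → (k : ℕ) → Fin n → Graph (n + suc k)
lsva {n} G k v x y = lsvaAdj {n} {k} G v (splitAt n x) (splitAt n y)

{-# OPTIONS --safe #-}
module Submission where

-- Let Δ = maxDeg G and k = Δ − 1.  The new vertex w has degree k + 1 = Δ and no other
-- degree exceeds Δ, so Δ(G′) = Δ.  A minimum vertex cover of G′ is one of G plus w, so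
-- β(G′) = β(G) + 1.  For zero forcing, Z(G′) = Z(G) + k − 1: a zero forcing set of G
-- together with all pendants but one is a zero forcing set of G′ (a blue pendant forces w,
-- the forcing process of G then runs unchanged, and w finally forces the last pendant).
-- Conversely a zero forcing set of G′ has at most one white pendant, since w never forces
-- while two of its pendants are white, and its restriction to G, enlarged by v when all
-- pendants are blue, is a zero forcing set of G.  Hence
-- Z(G′) = (Δ − 2) β(G) + 1 + (Δ − 2) = (Δ − 2) β(G′) + 1.

open import Defs
open import Algebra.Properties.CommutativeSemigroup using (interchange)
open import Data.Bool using (Bool; true; false; if_then_else_; T)
open import Data.Bool.Properties using (¬-not) renaming (_≟_ to _≟ᵇ_)
open import Data.Empty using (⊥; ⊥-elim)
open import Data.Fin using (Fin; zero; suc; splitAt; _≟_; _↑ˡ_; _↑ʳ_)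
open import Data.Fin.Properties
  using (splitAt-↑ˡ; splitAt-↑ʳ; splitAt⁻¹-↑ˡ; splitAt⁻¹-↑ʳ; ↑ˡ-injective; ↑ʳ-injective; suc-injective; all?; ¬∀⟶∃¬)
open import Data.List using (allFin; tabulate)
open import Data.List.Membership.Propositional.Properties using (∈-allFin)
open import Data.List.Properties using (map-cong; map-tabulate; foldr-preservesᵇ; foldr-preservesᵒ)
import Data.List.Relation.Unary.All.Properties as All
import Data.List.Relation.Unary.Any as Any
import Data.List.Relation.Unary.Any.Properties as Any
open import Data.Nat using (ℕ; zero; suc; _+_; _*_; _∸_; _≤_; _⊔_; z≤n; s≤s)
open import Data.Nat.ListAction using (sum)
open import Data.Nat.Properties
  using ( ≤-refl; ≤-reflexive; ≤-trans; ≤-antisym; ≤-pred; +-mono-≤; +-monoʳ-≤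
        ; +-assoc; +-suc; +-comm; +-identityʳ; m≤n+m; m≤n⇒m≤1+n; ⊔-lub; m≤n⇒m≤n⊔o; m≤n⇒m≤o⊔n
        ; +-commutativeSemigroup; module ≤-Reasoning)
open import Data.Nat.Tactic.RingSolver using (solve-∀)
open import Data.Product using (Σ; _×_; _,_; proj₁)
open import Data.Sum using (_⊎_; inj₁; inj₂; [_,_]; [_,_]′; map)
open import Data.Unit using (tt)
open import Data.Vec.Functional using (_++_; _∷_)
open import Data.Vec.Functional.Properties using (lookup-++ˡ; lookup-++ʳ)
open import Function using (_∘_; id; const)
open import Relation.Nullary using (¬_; yes; no)
open import Relation.Nullary.Decidable using (⌊_⌋; ⌊⌋-map′; toWitness)
open import Relation.Binary.PropositionalEquality hiding ([_])

private
  variable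
    m n : ℕ

bit : Bool → ℕ
bit b = if b then 1 else 0

-- Counting vertex sets

count-tabulate : (S : Fin n → Bool) → count S ≡ sum (tabulate (bit ∘ S))
count-tabulate S = cong sum (map-tabulate id (bit ∘ S))

count-suc : (S : Fin (suc n) → Bool) → count S ≡ bit (S zero) + count (S ∘ suc)
count-suc S = trans (count-tabulate S) (cong (bit (S zero) +_) (sym (count-tabulate (S ∘ suc))))

count-cong : {S T : Fin n → Bool} → S ≗ T → count S ≡ count T
count-cong S≗T = cong sum (map-cong (cong bit ∘ S≗T) (allFin _))

count-split : ∀ m (S : Fin (m + n) → Bool) → count S ≡ count (S ∘ (_↑ˡ n)) + count (S ∘ (m ↑ʳ_))
count-split zero S = refl
count-split {n} (suc m) S = begin
  count S
    ≡⟨ count-suc S ⟩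
  bit (S zero) + count (S ∘ suc)
    ≡⟨ cong (bit (S zero) +_) (count-split m (S ∘ suc)) ⟩
  bit (S zero) + (count (S ∘ suc ∘ (_↑ˡ n)) + count (S ∘ suc ∘ (m ↑ʳ_)))
    ≡⟨ +-assoc (bit (S zero)) _ _ ⟨
  bit (S zero) + count (S ∘ suc ∘ (_↑ˡ n)) + count (S ∘ suc ∘ (m ↑ʳ_))
    ≡⟨ cong (_+ count (S ∘ suc ∘ (m ↑ʳ_))) (count-suc (S ∘ (_↑ˡ n))) ⟨
  count (S ∘ (_↑ˡ n)) + count (S ∘ (suc m ↑ʳ_))
    ∎
  where open ≡-Reasoning

count-++ : (S : Fin m → Bool) (T : Fin n → Bool) → count (S ++ T) ≡ count S + count T
count-++ {m} S T =
  trans (count-split m (S ++ T)) (cong₂ _+_ (count-cong (lookup-++ˡ S T)) (count-cong (lookup-++ʳ S T)))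

count-false : {S : Fin n → Bool} → (∀ i → S i ≡ false) → count S ≡ 0
count-false {zero} _ = refl
count-false {suc n} {S} S≡false =
  trans (count-suc S) (cong₂ _+_ (cong bit (S≡false zero)) (count-false (S≡false ∘ suc)))

count-true : {S : Fin n → Bool} → (∀ i → S i ≡ true) → count S ≡ n
count-true {zero} _ = refl
count-true {suc n} {S} S≡true =
  trans (count-suc S) (cong₂ _+_ (cong bit (S≡true zero)) (count-true (S≡true ∘ suc)))

≟-true⇒≡ : {a c : Fin n} → ⌊ a ≟ c ⌋ ≡ true → a ≡ c
≟-true⇒≡ h = toWitness (subst T (sym h) tt)

≡⇒≟-true : {a c : Fin n} → a ≡ c → ⌊ a ≟ c ⌋ ≡ true
≡⇒≟-true a≡c = cong ⌊_⌋ (≡-≟-identity _≟_ a≡c)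

count-≟ : (v : Fin n) → count (λ a → ⌊ a ≟ v ⌋) ≡ 1
count-≟ {suc n} zero =
  trans (count-suc {n} (λ a → ⌊ a ≟ zero ⌋)) (cong suc (count-false {n} {λ a → ⌊ suc a ≟ zero ⌋} (λ _ → refl)))
count-≟ {suc n} (suc v) = begin
  count (λ a → ⌊ a ≟ suc v ⌋)            ≡⟨ count-suc {n} (λ a → ⌊ a ≟ suc v ⌋) ⟩
  count (λ a → ⌊ suc a ≟ suc v ⌋)        ≡⟨ count-cong (λ a → ⌊⌋-map′ _ _ (a ≟ v)) ⟩
  count (λ a → ⌊ a ≟ v ⌋)                ≡⟨ count-≟ v ⟩
  1                                      ∎
  where open ≡-Reasoning

bit-⊆∪ : {a b c : Bool} → (a ≡ true → b ≡ true ⊎ c ≡ true) → bit a ≤ bit b + bit c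
bit-⊆∪ {false} _ = z≤n
bit-⊆∪ {true} {b} {c} a⊆b∪c with a⊆b∪c refl
... | inj₁ refl = s≤s z≤n
... | inj₂ refl = m≤n+m 1 (bit b)

count-⊆∪ : {S T U : Fin n → Bool} → (∀ i → S i ≡ true → T i ≡ true ⊎ U i ≡ true) →
           count S ≤ count T + count U
count-⊆∪ {zero} _ = z≤n
count-⊆∪ {suc n} {S} {T} {U} S⊆T∪U = begin
  count S
    ≡⟨ count-suc S ⟩
  bit (S zero) + count (S ∘ suc)
    ≤⟨ +-mono-≤ (bit-⊆∪ (S⊆T∪U zero)) (count-⊆∪ (S⊆T∪U ∘ suc)) ⟩
  (bit (T zero) + bit (U zero)) + (count (T ∘ suc) + count (U ∘ suc))
    ≡⟨ interchange +-commutativeSemigroup (bit (T zero)) (bit (U zero)) (count (T ∘ suc)) (count (U ∘ suc)) ⟩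
  (bit (T zero) + count (T ∘ suc)) + (bit (U zero) + count (U ∘ suc))
    ≡⟨ cong₂ _+_ (count-suc T) (count-suc U) ⟨
  count T + count U
    ∎
  where open ≤-Reasoning

count-mono : {S T : Fin n → Bool} → (∀ i → S i ≡ true → T i ≡ true) → count S ≤ count T
count-mono {n} {S} {T} S⊆T = begin
  count S                            ≤⟨ count-⊆∪ {T = T} {U = const false} (λ i → inj₁ ∘ S⊆T i) ⟩
  count T + count {n} (const false)  ≡⟨ cong (count T +_) (count-false {n} {const false} (λ _ → refl)) ⟩
  count T + 0                        ≡⟨ +-identityʳ _ ⟩
  count T                            ∎
  where open ≤-Reasoning

1≤count : {S : Fin n → Bool} (i : Fin n) → S i ≡ true → 1 ≤ count S
1≤count {S = S} i Si = subst (_≤ count S) (count-≟ i)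
  (count-mono {S = λ a → ⌊ a ≟ i ⌋} {S} (λ a a≟i → subst (λ x → S x ≡ true) (sym (≟-true⇒≡ a≟i)) Si))

-- Maximum degree

deg≤maxDeg : (G : Graph n) (a : Fin n) → deg G a ≤ maxDeg G
deg≤maxDeg G a = foldr-preservesᵒ {P = deg G a ≤_} {f = _⊔_}
  (λ x y → [ m≤n⇒m≤n⊔o y , m≤n⇒m≤o⊔n x ]) 0 _
  (inj₂ (Any.map⁺ (Any.map (λ { refl → ≤-refl }) (∈-allFin a))))

maxDeg-lub : (G : Graph n) {d : ℕ} → (∀ a → deg G a ≤ d) → maxDeg G ≤ d
maxDeg-lub G {d} bound = foldr-preservesᵇ {P = _≤ d} {f = _⊔_} ⊔-lub z≤n (All.map⁺ (All.tabulate⁺ bound))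

-- Zero forcing

paint-hit : (X : VSet n) (u : Fin n) → paint X u u ≡ true
paint-hit X u = cong (if_then true else X u) (≡⇒≟-true refl)

paint-keep : (X : VSet n) (u : Fin n) {y : Fin n} → X y ≡ true → paint X u y ≡ true
paint-keep X u {y} Xy with y ≟ u
... | yes _ = refl
... | no _ = Xy

paint-miss : (X : VSet n) {u y : Fin n} → ¬ y ≡ u → paint X u y ≡ X y
paint-miss X {u} {y} y≢u with y ≟ u
... | yes y≡u = ⊥-elim (y≢u y≡u)
... | no _ = refl

paint-cases : (X : VSet n) {u y : Fin n} → paint X u y ≡ true → y ≡ u ⊎ X y ≡ true
paint-cases X {u} {y} h with y ≟ u
... | yes y≡u = inj₁ y≡u
... | no _ = inj₂ h

count-paint : (X : VSet n) (u : Fin n) → count (paint X u) ≤ suc (count X)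
count-paint X u = begin
  count (paint X u)
    ≤⟨ count-⊆∪ {T = λ i → ⌊ i ≟ u ⌋} (λ i h → map ≡⇒≟-true id (paint-cases X h)) ⟩
  count (λ i → ⌊ i ≟ u ⌋) + count X
    ≡⟨ cong (_+ count X) (count-≟ u) ⟩
  suc (count X)
    ∎
  where open ≤-Reasoning

true≢false : {b : Bool} → b ≡ true → ¬ b ≡ false
true≢false refl ()

others-blue : {G : Graph n} {X : VSet n} {f t y : Fin n} →
              (∀ y → G f y ≡ true → X y ≡ false → y ≡ t) → G f y ≡ true → ¬ y ≡ t → X y ≡ true
others-blue {X = X} {y = y} unique fy y≢t with X y in Xy
... | true = refl
... | false = ⊥-elim (y≢t (unique y fy Xy))

Forces-++ : {G : Graph n} {X Y Z : VSet n} → Forces G X Y → Forces G Y Z → Forces G X Z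
Forces-++ done q = q
Forces-++ (step f p) q = step f (Forces-++ p q)

Forces-preserves : {G : Graph n} (I : VSet n → Set) → (∀ {X X′} → Force G X X′ → I X → I X′) →
                   ∀ {X Y} → Forces G X Y → I X → I Y
Forces-preserves I pres done i = i
Forces-preserves I pres (step f fs) i = Forces-preserves I pres fs (pres f i)

Forces-simulate : {G : Graph m} {H : Graph n} (R : VSet m → VSet n → Set) →
                  (∀ {X X′ P} → Force G X X′ → R X P → Σ (VSet n) λ P′ → Forces H P P′ × R X′ P′) →
                  ∀ {X Y P} → Forces G X Y → R X P → Σ (VSet n) λ P′ → Forces H P P′ × R Y P′
Forces-simulate R sim done r = _ , done , r
Forces-simulate R sim (step f fs) r =
  let P₁ , ps₁ , r₁ = sim f r
      P₂ , ps₂ , r₂ = Forces-simulate R sim fs r₁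
  in P₂ , Forces-++ ps₁ ps₂ , r₂

zf-backward : {G : Graph n} {X Y : VSet n} → Forces G X Y → IsZeroForcingSet G Y → IsZeroForcingSet G X
zf-backward X→Y (Z , Y→Z , allZ) = Z , Forces-++ X→Y Y→Z , allZ

-- Leaf support vertex addition

module LSVA {n k : ℕ} (G : Graph n) (v : Fin n) where

  G′ : Graph (n + suc k)
  G′ = lsva G k v

  ι : Fin n → Fin (n + suc k)
  ι a = a ↑ˡ suc k

  w : Fin (n + suc k)
  w = n ↑ʳ zero

  leaf : Fin k → Fin (n + suc k)
  leaf j = n ↑ʳ suc j

  data Vertex : Fin (n + suc k) → Set where
    old     : ∀ a → Vertex (ι a)
    support : Vertex w
    pendant : ∀ j → Vertex (leaf j)

  vertex : ∀ x → Vertex x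
  vertex x with splitAt n x in eq
  ... | inj₁ a       = subst Vertex (splitAt⁻¹-↑ˡ eq) (old a)
  ... | inj₂ zero    = subst Vertex (splitAt⁻¹-↑ʳ eq) support
  ... | inj₂ (suc j) = subst Vertex (splitAt⁻¹-↑ʳ eq) (pendant j)

  ι-injective : ∀ {a c} → ι a ≡ ι c → a ≡ c
  ι-injective = ↑ˡ-injective (suc k) _ _

  leaf-injective : ∀ {i j} → leaf i ≡ leaf j → i ≡ j
  leaf-injective e = suc-injective (↑ʳ-injective n _ _ e)

  ι≢↑ʳ : ∀ a j → ¬ ι a ≡ n ↑ʳ j
  ι≢↑ʳ a j e with trans (sym (splitAt-↑ˡ n a (suc k))) (trans (cong (splitAt n) e) (splitAt-↑ʳ n (suc k) j))
  ... | ()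

  ι≢w : ∀ a → ¬ ι a ≡ w
  ι≢w a = ι≢↑ʳ a zero

  ι≢leaf : ∀ a j → ¬ ι a ≡ leaf j
  ι≢leaf a j = ι≢↑ʳ a (suc j)

  w≢leaf : ∀ j → ¬ w ≡ leaf j
  w≢leaf j e with ↑ʳ-injective n zero (suc j) e
  ... | ()

  adj-ιι : ∀ a c → G′ (ι a) (ι c) ≡ G a c
  adj-ιι a c rewrite splitAt-↑ˡ n a (suc k) | splitAt-↑ˡ n c (suc k) = refl

  adj-ιw : ∀ a → G′ (ι a) w ≡ ⌊ a ≟ v ⌋
  adj-ιw a rewrite splitAt-↑ˡ n a (suc k) | splitAt-↑ʳ n (suc k) zero = refl

  adj-wι : ∀ a → G′ w (ι a) ≡ ⌊ a ≟ v ⌋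
  adj-wι a rewrite splitAt-↑ˡ n a (suc k) | splitAt-↑ʳ n (suc k) zero = refl

  adj-w-leaf : ∀ j → G′ w (leaf j) ≡ true
  adj-w-leaf j rewrite splitAt-↑ʳ n (suc k) zero | splitAt-↑ʳ n (suc k) (suc j) = refl

  adj-leaf-w : ∀ j → G′ (leaf j) w ≡ true
  adj-leaf-w j rewrite splitAt-↑ʳ n (suc k) zero | splitAt-↑ʳ n (suc k) (suc j) = refl

  adj-ι-leaf : ∀ a j → G′ (ι a) (leaf j) ≡ false
  adj-ι-leaf a j rewrite splitAt-↑ˡ n a (suc k) | splitAt-↑ʳ n (suc k) (suc j) = refl

  adj-leaf-ι : ∀ j a → G′ (leaf j) (ι a) ≡ false
  adj-leaf-ι j a rewrite splitAt-↑ˡ n a (suc k) | splitAt-↑ʳ n (suc k) (suc j) = refl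

  adj-leaf-leaf : ∀ i j → G′ (leaf i) (leaf j) ≡ false
  adj-leaf-leaf i j rewrite splitAt-↑ʳ n (suc k) (suc i) | splitAt-↑ʳ n (suc k) (suc j) = refl

  adj-ww : G′ w w ≡ false
  adj-ww rewrite splitAt-↑ʳ n (suc k) zero = refl

  adj-wv : G′ w (ι v) ≡ true
  adj-wv = trans (adj-wι v) (≡⇒≟-true refl)

  count-lsva : (X : VSet (n + suc k)) → count X ≡ count (X ∘ ι) + (bit (X w) + count (X ∘ leaf))
  count-lsva X = trans (count-split n X) (cong (count (X ∘ ι) +_) (count-suc (X ∘ (n ↑ʳ_))))

  deg-old : ∀ a → deg G′ (ι a) ≡ deg G a + bit ⌊ a ≟ v ⌋
  deg-old a = begin
    count (G′ (ι a))
      ≡⟨ count-lsva (G′ (ι a)) ⟩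
    count (G′ (ι a) ∘ ι) + (bit (G′ (ι a) w) + count (G′ (ι a) ∘ leaf))
      ≡⟨ cong₂ _+_ (count-cong (adj-ιι a)) (cong₂ _+_ (cong bit (adj-ιw a)) (count-false (adj-ι-leaf a))) ⟩
    deg G a + (bit ⌊ a ≟ v ⌋ + 0)
      ≡⟨ cong (deg G a +_) (+-identityʳ _) ⟩
    deg G a + bit ⌊ a ≟ v ⌋
      ∎
    where open ≡-Reasoning

  deg-support : deg G′ w ≡ suc k
  deg-support = begin
    count (G′ w)
      ≡⟨ count-lsva (G′ w) ⟩
    count (G′ w ∘ ι) + (bit (G′ w w) + count (G′ w ∘ leaf))
      ≡⟨ cong₂ _+_ (trans (count-cong adj-wι) (count-≟ v)) (cong₂ _+_ (cong bit adj-ww) (count-true adj-w-leaf)) ⟩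
    suc k
      ∎
    where open ≡-Reasoning

  deg-pendant : ∀ j → deg G′ (leaf j) ≡ 1
  deg-pendant j = begin
    count (G′ (leaf j))
      ≡⟨ count-lsva (G′ (leaf j)) ⟩
    count (G′ (leaf j) ∘ ι) + (bit (G′ (leaf j) w) + count (G′ (leaf j) ∘ leaf))
      ≡⟨ cong₂ _+_ (count-false (adj-leaf-ι j)) (cong₂ _+_ (cong bit (adj-leaf-w j)) (count-false (adj-leaf-leaf j))) ⟩
    1
      ∎
    where open ≡-Reasoning

  deg-old≤ : (∀ a → deg G a ≤ suc k) → deg G v ≤ k → ∀ a → deg G′ (ι a) ≤ suc k
  deg-old≤ deg≤ degv≤ a rewrite deg-old a with a ≟ v
  ... | yes refl = subst (_≤ suc k) (+-comm 1 (deg G v)) (s≤s degv≤)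
  ... | no _ = subst (_≤ suc k) (sym (+-identityʳ (deg G a))) (deg≤ a)

  maxDeg-lsva : (∀ a → deg G a ≤ suc k) → deg G v ≤ k → maxDeg G′ ≡ suc k
  maxDeg-lsva deg≤ degv≤ =
    ≤-antisym (maxDeg-lub G′ (deg≤suc-k ∘ vertex)) (subst (_≤ maxDeg G′) deg-support (deg≤maxDeg G′ w))
    where
    deg≤suc-k : ∀ {x} → Vertex x → deg G′ x ≤ suc k
    deg≤suc-k (old a) = deg-old≤ deg≤ degv≤ a
    deg≤suc-k support = ≤-reflexive deg-support
    deg≤suc-k (pendant j) = subst (_≤ suc k) (sym (deg-pendant j)) (s≤s z≤n)

  with-support : VSet n → VSet (n + suc k)
  with-support S = S ++ (true ∷ const false)

  cover-extend : ∀ {S} → IsVertexCover G S → IsVertexCover G′ (with-support S)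
  cover-extend {S} cover x y xy = go (vertex x) (vertex y) xy
    where
    S′-w : with-support S w ≡ true
    S′-w = lookup-++ʳ S (true ∷ const false) zero
    go : ∀ {x y} → Vertex x → Vertex y → G′ x y ≡ true → with-support S x ≡ true ⊎ with-support S y ≡ true
    go _ support _ = inj₂ S′-w
    go support _ _ = inj₁ S′-w
    go (old a) (old c) ac =
      map (trans (lookup-++ˡ S _ a)) (trans (lookup-++ˡ S _ c)) (cover a c (trans (sym (adj-ιι a c)) ac))
    go (old a) (pendant j) h = ⊥-elim (true≢false h (adj-ι-leaf a j))
    go (pendant j) (old a) h = ⊥-elim (true≢false h (adj-leaf-ι j a))
    go (pendant i) (pendant j) h = ⊥-elim (true≢false h (adj-leaf-leaf i j))

  count-with-support : (S : VSet n) → count (with-support S) ≡ suc (count S)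
  count-with-support S = begin
    count (with-support S)                        ≡⟨ count-++ S (true ∷ const false) ⟩
    count S + count {suc k} (true ∷ const false)  ≡⟨ cong (count S +_) (trans (count-suc {k} (true ∷ const false))
                                                       (cong suc (count-false {k} {const false} (λ _ → refl)))) ⟩
    count S + 1                                   ≡⟨ +-comm (count S) 1 ⟩
    suc (count S)                                 ∎
    where open ≡-Reasoning

  cover-restrict : ∀ {S} → IsVertexCover G′ S → IsVertexCover G (S ∘ ι)
  cover-restrict cover a c ac = cover (ι a) (ι c) (trans (adj-ιι a c) ac)

  cover-pendant-edge : ∀ {S} → IsVertexCover G′ S → Fin k → 1 ≤ bit (S w) + count (S ∘ leaf)
  cover-pendant-edge {S} cover j with cover w (leaf j) (adj-w-leaf j)
  ... | inj₁ Sw rewrite Sw = s≤s z≤n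
  ... | inj₂ Sj = ≤-trans (1≤count j Sj) (m≤n+m _ (bit (S w)))

  paint-old : (X : VSet (n + suc k)) (u a : Fin n) → paint X (ι u) (ι a) ≡ paint (X ∘ ι) u a
  paint-old X u a with a ≟ u
  ... | yes refl = paint-hit X (ι a)
  ... | no a≢u = paint-miss X (a≢u ∘ ι-injective)

  -- While w is blue, a force of G between old vertices is also a force of G′.
  Lifted : (Fin k → Bool) → VSet n → VSet (n + suc k) → Set
  Lifted L C X = (∀ a → X (ι a) ≡ C a) × X w ≡ true × (∀ j → X (leaf j) ≡ L j)

  lift-force : ∀ {L C C′ X} → Force G C C′ → Lifted L C X → Σ (VSet (n + suc k)) λ X′ → Forces G′ X X′ × Lifted L C′ X′
  lift-force {L} {C} {X = X} (force a u Ca au Cu unique) (Xι , Xw , Xleaf) =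
    paint X (ι u) ,
    step (force (ι a) (ι u) (trans (Xι a) Ca) (trans (adj-ιι a u) au) (trans (Xι u) Cu) (λ y → unique′ (vertex y))) done ,
    (λ c → trans (paint-old X u c) (cong (λ b → if ⌊ c ≟ u ⌋ then true else b) (Xι c))) ,
    trans (paint-miss X (ι≢w u ∘ sym)) Xw ,
    (λ j → trans (paint-miss X (ι≢leaf u j ∘ sym)) (Xleaf j))
    where
    unique′ : ∀ {y} → Vertex y → G′ (ι a) y ≡ true → X y ≡ false → y ≡ ι u
    unique′ (old c) ac Xc = cong ι (unique c (trans (sym (adj-ιι a c)) ac) (trans (sym (Xι c)) Xc))
    unique′ support _ Xw′ = ⊥-elim (true≢false Xw Xw′)
    unique′ (pendant j) h _ = ⊥-elim (true≢false h (adj-ι-leaf a j))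

  leaf-forces-support : ∀ {X} j → X (leaf j) ≡ true → X w ≡ false → Force G′ X (paint X w)
  leaf-forces-support j Xj Xw = force (leaf j) w Xj (adj-leaf-w j) Xw (λ y h _ → only-w (vertex y) h)
    where
    only-w : ∀ {y} → Vertex y → G′ (leaf j) y ≡ true → y ≡ w
    only-w (old a) h = ⊥-elim (true≢false h (adj-leaf-ι j a))
    only-w support _ = refl
    only-w (pendant i) h = ⊥-elim (true≢false h (adj-leaf-leaf j i))

  support-completes : ∀ {X} j → (∀ a → X (ι a) ≡ true) → X w ≡ true → X (leaf j) ≡ false →
                      (∀ i → ¬ i ≡ j → X (leaf i) ≡ true) → IsZeroForcingSet G′ X
  support-completes {X} j Xι Xw Xj Xothers =
    paint X (leaf j) , step (force w (leaf j) Xw (adj-w-leaf j) Xj (λ y h → unique (vertex y) h)) done ,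
    all-blue ∘ vertex
    where
    unique : ∀ {y} → Vertex y → G′ w y ≡ true → X y ≡ false → y ≡ leaf j
    unique (old a) _ Xa = ⊥-elim (true≢false (Xι a) Xa)
    unique support h _ = ⊥-elim (true≢false h adj-ww)
    unique (pendant i) _ Xi with i ≟ j
    ... | yes refl = refl
    ... | no i≢j = ⊥-elim (true≢false (Xothers i i≢j) Xi)
    all-blue : ∀ {x} → Vertex x → paint X (leaf j) x ≡ true
    all-blue (old a) = paint-keep X (leaf j) (Xι a)
    all-blue support = paint-keep X (leaf j) Xw
    all-blue (pendant i) with i ≟ j
    ... | yes refl = paint-hit X (leaf i)
    ... | no i≢j = paint-keep X (leaf j) (Xothers i i≢j)

  -- P follows a forcing run of G′ inside G.  Since w can force v only after all its
  -- pendants are blue, v has to be blue in P only from then on.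
  Projects : VSet (n + suc k) → VSet n → Set
  Projects X P = (∀ a → X (ι a) ≡ true → P a ≡ true) × ((∀ j → X (leaf j) ≡ true) → P v ≡ true)

  projects-white : ∀ {X P} → Projects X P → ∀ a → P a ≡ false → X (ι a) ≡ false
  projects-white {X} (P⊇X , _) a Pa with X (ι a) in Xa
  ... | true = ⊥-elim (true≢false (P⊇X a Xa) Pa)
  ... | false = refl

  project-paint-old : ∀ {X P P′ c} → Projects X P → (∀ a → P a ≡ true → P′ a ≡ true) → P′ c ≡ true →
                      Projects (paint X (ι c)) P′
  project-paint-old {X} {P} {P′} {c} (P⊇X , leaves⇒Pv) P⊆P′ P′c =
    (λ a h → [ (λ e → subst (λ x → P′ x ≡ true) (sym (ι-injective e)) P′c) , P⊆P′ a ∘ P⊇X a ]′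
               (paint-cases X h)) ,
    (λ blue → P⊆P′ v (leaves⇒Pv (λ j → trans (sym (paint-miss X (ι≢leaf c j ∘ sym))) (blue j))))

  project-paint-new : ∀ {X P t} → Projects X P → (∀ a → ¬ ι a ≡ t) →
                      ((∀ j → paint X t (leaf j) ≡ true) → P v ≡ true) → Projects (paint X t) P
  project-paint-new {X} (P⊇X , _) t-new leaves⇒Pv =
    (λ a h → [ ⊥-elim ∘ t-new a , P⊇X a ]′ (paint-cases X h)) , leaves⇒Pv

  project-force : ∀ {X X′ P} → Force G′ X X′ → Projects X P → Σ (VSet n) λ P′ → Forces G P P′ × Projects X′ P′
  project-force {X} {P = P} (force f t Xf ft Xt unique) pr@(P⊇X , leaves⇒Pv) with vertex f | vertex t
  ... | _ | support =
    P , done ,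
    project-paint-new {X} pr ι≢w (λ blue → leaves⇒Pv (λ j → trans (sym (paint-miss X (w≢leaf j ∘ sym))) (blue j)))
  ... | support | old c =
    P , done , project-paint-old {X} pr (λ _ → id)
      (subst (λ x → P x ≡ true) (sym (≟-true⇒≡ (trans (sym (adj-wι c)) ft)))
        (leaves⇒Pv (λ j → others-blue {G = G′} {X} unique (adj-w-leaf j) (ι≢leaf c j ∘ sym))))
  ... | support | pendant j =
    P , done ,
    project-paint-new {X} pr (λ a → ι≢leaf a j) (λ _ → P⊇X v (others-blue {G = G′} {X} unique adj-wv (ι≢leaf v j)))
  ... | old a | pendant j = ⊥-elim (true≢false ft (adj-ι-leaf a j))
  ... | pendant i | old c = ⊥-elim (true≢false ft (adj-leaf-ι i c))
  ... | pendant i | pendant j = ⊥-elim (true≢false ft (adj-leaf-leaf i j))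
  ... | old a | old c with P c in Pc
  ...   | true = P , done , project-paint-old {X} pr (λ _ → id) Pc
  ...   | false =
    paint P c , step (force a c (P⊇X a Xf) (trans (sym (adj-ιι a c)) ft) Pc unique-in-G) done ,
    project-paint-old {X} pr (λ _ → paint-keep P c) (paint-hit P c)
    where
    unique-in-G : ∀ y → G a y ≡ true → P y ≡ false → y ≡ c
    unique-in-G y ay Py = ι-injective (unique (ι y) (trans (adj-ιι a y) ay) (projects-white {X} pr y Py))

  project-zf : ∀ {X P} → IsZeroForcingSet G′ X → Projects X P → IsZeroForcingSet G P
  project-zf (Y , X→Y , allY) pr =
    let P′ , P→P′ , (P′⊇Y , _) = Forces-simulate Projects project-force X→Y pr
    in P′ , P→P′ , λ a → P′⊇Y a (allY (ι a))

  force-preserves-white-pendant : ∀ {X X′ i j} → Force G′ X X′ → ¬ i ≡ j →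
                              X (leaf i) ≡ false → X (leaf j) ≡ false → X′ (leaf i) ≡ false
  force-preserves-white-pendant {X} {i = i} {j} (force f t Xf ft Xt unique) i≢j Xi Xj with leaf i ≟ t
  ... | no _ = Xi
  ... | yes refl = ⊥-elim (no-forcer (vertex f) ft unique)
    where
    no-forcer : ∀ {f} → Vertex f → G′ f (leaf i) ≡ true → (∀ y → G′ f y ≡ true → X y ≡ false → y ≡ leaf i) → ⊥
    no-forcer (old a) h _ = true≢false h (adj-ι-leaf a i)
    no-forcer (pendant l) h _ = true≢false h (adj-leaf-leaf l i)
    no-forcer support _ unique′ = i≢j (sym (leaf-injective (unique′ (leaf j) (adj-w-leaf j) Xj)))

  pendants-blue-but-one : ∀ {X j} → IsZeroForcingSet G′ X → X (leaf j) ≡ false → ∀ i → ¬ i ≡ j → X (leaf i) ≡ true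
  pendants-blue-but-one {X} {j} (Y , X→Y , allY) Xj i i≢j with X (leaf i) in Xi
  ... | true = refl
  ... | false = ⊥-elim (true≢false (allY (leaf i)) (proj₁ (Forces-preserves BothWhite keep X→Y (Xi , Xj))))
    where
    BothWhite : VSet (n + suc k) → Set
    BothWhite Z = Z (leaf i) ≡ false × Z (leaf j) ≡ false
    keep : ∀ {Z Z′} → Force G′ Z Z′ → BothWhite Z → BothWhite Z′
    keep f (Zi , Zj) = force-preserves-white-pendant f i≢j Zi Zj , force-preserves-white-pendant f (i≢j ∘ sym) Zj Zi

  zf-size-lower : ∀ {z X} → (∀ B → IsZeroForcingSet G B → z ≤ count B) → IsZeroForcingSet G′ X →
                  z + k ≤ suc (count X)
  zf-size-lower {z} {X} minimal zfX with all? (λ j → X (leaf j) ≟ᵇ true)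
  ... | yes leaves-blue = begin
    z + k                                                 ≤⟨ +-mono-≤ z≤ k≤ ⟩
    suc (count (X ∘ ι)) + (bit (X w) + count (X ∘ leaf))  ≡⟨ cong suc (count-lsva X) ⟨
    suc (count X)                                         ∎
    where
    open ≤-Reasoning
    z≤ : z ≤ suc (count (X ∘ ι))
    z≤ = ≤-trans (minimal _ (project-zf zfX ((λ a → paint-keep (X ∘ ι) v) , λ _ → paint-hit (X ∘ ι) v)))
                 (count-paint (X ∘ ι) v)
    k≤ : k ≤ bit (X w) + count (X ∘ leaf)
    k≤ = ≤-trans (subst (_≤ count (X ∘ leaf)) (count-true {k} {const true} (λ _ → refl))
                        (count-mono (λ j _ → leaves-blue j)))
                 (m≤n+m _ (bit (X w)))
  ... | no ¬leaves-blue with ¬∀⟶∃¬ k _ (λ j → X (leaf j) ≟ᵇ true) ¬leaves-blue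
  ...   | j , Xj≢true = begin
    z + k                                                 ≤⟨ +-mono-≤ z≤ k≤ ⟩
    count (X ∘ ι) + suc (count (X ∘ leaf))                ≤⟨ +-monoʳ-≤ (count (X ∘ ι)) (s≤s (m≤n+m _ (bit (X w)))) ⟩
    count (X ∘ ι) + suc (bit (X w) + count (X ∘ leaf))    ≡⟨ +-suc (count (X ∘ ι)) _ ⟩
    suc (count (X ∘ ι) + (bit (X w) + count (X ∘ leaf)))  ≡⟨ cong suc (count-lsva X) ⟨
    suc (count X)                                         ∎
    where
    open ≤-Reasoning
    z≤ : z ≤ count (X ∘ ι)
    z≤ = minimal _ (project-zf zfX ((λ _ → id) , λ blue → ⊥-elim (Xj≢true (blue j))))
    k≤ : k ≤ suc (count (X ∘ leaf))
    k≤ = begin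
      k                                           ≡⟨ count-true {k} (λ _ → refl) ⟨
      count {k} (const true)                      ≤⟨ count-⊆∪ {T = λ i → ⌊ i ≟ j ⌋} (λ i _ → white-or-blue i) ⟩
      count (λ i → ⌊ i ≟ j ⌋) + count (X ∘ leaf)  ≡⟨ cong (_+ count (X ∘ leaf)) (count-≟ j) ⟩
      suc (count (X ∘ leaf))                      ∎
      where
      white-or-blue : ∀ i → ⌊ i ≟ j ⌋ ≡ true ⊎ X (leaf i) ≡ true
      white-or-blue i with i ≟ j
      ... | yes _ = inj₁ refl
      ... | no i≢j = inj₂ (pendants-blue-but-one zfX (¬-not Xj≢true) i i≢j)

vertexCoverNumber-lsva : {G : Graph n} {v : Fin n} {k b b′ : ℕ} → IsVertexCoverNumber G b →
                         IsVertexCoverNumber (lsva G (suc k) v) b′ → b′ ≡ suc b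
vertexCoverNumber-lsva {n} {G} {v} {k} {b} {b′} ((S , cover , |S|) , minimal) ((S′ , cover′ , |S′|) , minimal′) =
  ≤-antisym upper lower
  where
  open LSVA {n} {suc k} G v
  open ≤-Reasoning
  upper : b′ ≤ suc b
  upper = begin
    b′                                          ≤⟨ minimal′ _ (cover-extend cover) ⟩
    count (with-support S)                      ≡⟨ count-with-support S ⟩
    suc (count S)                               ≡⟨ cong suc |S| ⟩
    suc b                                       ∎
  lower : suc b ≤ b′
  lower = begin
    suc b                                                   ≡⟨ +-comm 1 b ⟩
    b + 1                                                   ≤⟨ +-mono-≤ (minimal _ (cover-restrict cover′)) (cover-pendant-edge cover′ zero) ⟩
    count (S′ ∘ ι) + (bit (S′ w) + count (S′ ∘ leaf))       ≡⟨ count-lsva S′ ⟨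
    count S′                                                ≡⟨ |S′| ⟩
    b′                                                      ∎

-- w and the first pendant are white, all other pendants blue.
zf-lsva : {G : Graph n} {v : Fin n} {k : ℕ} {B : VSet n} → IsZeroForcingSet G B →
          IsZeroForcingSet (lsva G (2 + k) v) (B ++ (false ∷ false ∷ const true))
zf-lsva {n} {G} {v} {k} {B} (C , B→C , allC) =
  let Y , X₁→Y , Yι , Yw , Yleaf = Forces-simulate (Lifted L) lift-force B→C X₁-lifted
  in zf-backward (step (leaf-forces-support (suc zero) X₀-leaf₁ X₀-w) X₁→Y)
       (support-completes zero (λ a → trans (Yι a) (allC a)) Yw (Yleaf zero)
         λ { zero 0≢0 → ⊥-elim (0≢0 refl) ; (suc i) _ → Yleaf (suc i) })
  where
  open LSVA {n} {2 + k} G v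
  L : Fin (2 + k) → Bool
  L = false ∷ const true
  X₀ : VSet (n + suc (2 + k))
  X₀ = B ++ (false ∷ L)
  X₀-leaf₁ : X₀ (leaf (suc zero)) ≡ true
  X₀-leaf₁ = lookup-++ʳ B (false ∷ L) (suc (suc zero))
  X₀-w : X₀ w ≡ false
  X₀-w = lookup-++ʳ B (false ∷ L) zero
  X₁-lifted : Lifted L B (paint X₀ w)
  X₁-lifted = (λ a → trans (paint-miss X₀ (ι≢w a)) (lookup-++ˡ B _ a)) ,
              paint-hit X₀ w ,
              (λ j → trans (paint-miss X₀ (w≢leaf j ∘ sym)) (lookup-++ʳ B (false ∷ L) (suc j)))

zeroForcingNumber-lsva : {G : Graph n} {v : Fin n} {k z z′ : ℕ} → IsZeroForcingNumber G z →
                         IsZeroForcingNumber (lsva G (2 + k) v) z′ → z′ ≡ z + suc k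
zeroForcingNumber-lsva {n} {G} {v} {k} {z} {z′} ((B , zfB , |B|) , minimal) ((B′ , zfB′ , |B′|) , minimal′) =
  ≤-antisym upper lower
  where
  open ≤-Reasoning
  upper : z′ ≤ z + suc k
  upper = begin
    z′                                                   ≤⟨ minimal′ _ (zf-lsva zfB) ⟩
    count (B ++ (false ∷ false ∷ const true))            ≡⟨ count-++ B (false ∷ false ∷ const true) ⟩
    count B + count {3 + k} (false ∷ false ∷ const true)
      ≡⟨ cong₂ _+_ |B| (trans (count-suc {2 + k} (false ∷ false ∷ const true))
                         (trans (count-suc {suc k} (false ∷ const true)) (count-true {suc k} {const true} (λ _ → refl)))) ⟩
    z + suc k                                            ∎
  lower : z + suc k ≤ z′
  lower = ≤-pred (begin
    suc (z + suc k)                                      ≡⟨ +-suc z (suc k) ⟨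
    z + (2 + k)                                          ≤⟨ LSVA.zf-size-lower G v minimal zfB′ ⟩
    suc (count B′)                                       ≡⟨ cong suc |B′| ⟩
    suc z′                                               ∎)

mainTheorem4 : (n : ℕ) (G : Graph n) → SimpleGraph G → 3 ≤ maxDeg G →
    (z b : ℕ) → IsZeroForcingNumber G z → IsVertexCoverNumber G b →
    z ≡ (maxDeg G ∸ 2) * b + 1 →
    (v : Fin n) → deg G v ≤ (maxDeg G ∸ 1) ∸ 1 →
    (z′ b′ : ℕ) → IsZeroForcingNumber (lsva G (maxDeg G ∸ 1) v) z′ →
    IsVertexCoverNumber (lsva G (maxDeg G ∸ 1) v) b′ →
    z′ ≡ (maxDeg (lsva G (maxDeg G ∸ 1) v) ∸ 2) * b′ + 1
mainTheorem4 n G _ 3≤Δ z b zf vc z≡ v degv≤ z′ b′ zf′ vc′ with maxDeg G | 3≤Δ | deg≤maxDeg G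
... | _ | s≤s (s≤s (s≤s {n = k} _)) | deg≤Δ = begin
  z′                                        ≡⟨ zeroForcingNumber-lsva zf zf′ ⟩
  z + suc k                                 ≡⟨ cong (_+ suc k) z≡ ⟩
  suc k * b + 1 + suc k                     ≡⟨ absorb (suc k) b ⟩
  suc k * suc b + 1                         ≡⟨ cong₂ (λ Δ′ β′ → (Δ′ ∸ 2) * β′ + 1) Δ′≡ β′≡ ⟨
  (maxDeg G′ ∸ 2) * b′ + 1                  ∎
  where
  open ≡-Reasoning
  open LSVA {n} {2 + k} G v using (G′; maxDeg-lsva)
  Δ′≡ : maxDeg G′ ≡ 3 + k
  Δ′≡ = maxDeg-lsva deg≤Δ (m≤n⇒m≤1+n degv≤)
  β′≡ : b′ ≡ suc b
  β′≡ = vertexCoverNumber-lsva vc vc′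
  absorb : ∀ c b → c * b + 1 + c ≡ c * suc b + 1
  absorb = solve-∀
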